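{- Let $\mathsf{M}^*$ be an implicit knowledge-based HMS model and $FH^*(\mathsf{M}^*)$ its FH$^*$-transform. Then for all $\varphi\in\mathcal{L}_{\mathsf{At}}$ and all $\omega\in S_{\mathsf{At}}$: $\mathsf{M}^*,\omega\vDash\varphi$ if and only if $FH^*(\mathsf{M}^*),\omega\Vdash\varphi$.
   Context: Fix non-empty sets $\mathsf{At}$ (atoms) and $I$ (individuals). Language $\mathcal{L}_{\mathsf{At}}$: $\varphi::=\top\mid p\mid\neg\varphi\mid\varphi\wedge\psi\mid\ell_i\varphi\mid a_i\varphi\mid k_i\varphi$; $\mathsf{At}(\varphi)$ = atoms in $\varphi$; $\mathcal{L}_\Phi=\{\varphi:\mathsf{At}(\varphi)\subseteq\Phi\}$. An implicit knowledge-based HMS model $\mathsf{M}^*=\langle I,\{S_\Phi\},(r^\Phi_\Psi),(\Lambda_i),(\alpha_i),v\rangle$: non-empty pairwise disjoint spaces $S_\Phi$ ($\Phi\subseteq\mathsf{At}$), ordered $S_{\Phi'}\succeq S_\Phi$ iff $\Phi\subseteq\Phi'$; $\Omega=\bigcup_\Phi S_\Phi$; surjections $r^\Phi_\Psi:S_\Phi\to S_\Psi$ ($\Psi\subseteq\Phi$) with $r^\Phi_\Phi=\mathrm{id}$, $r^\Phi_\Upsilon=r^\Psi_\Upsilon\circ r^\Phi_\Psi$; $\omega_\Psi=r^\Phi_\Psi(\omega)$, $D_\Psi=r^\Phi_\Psi(D)$, $D^\uparrow=\bigcup_{\Phi\subseteq\Psi}(r^\Psi_\Phi)^{ -1}(D)$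 for $D\subseteq S_\Phi$. Events: $E=D^\uparrow$, base-space $S(E)=S_\Phi$ (vacuous events $\emptyset^{S_\Phi}$ distinguished by base-space); $\neg E=(S(E)\setminus D)^\uparrow$; conjunction = intersection; $v:\mathsf{At}\to$ events. $\Lambda_i:\Omega\to2^\Omega\setminus\{\emptyset\}$ satisfies Reflexivity ($\omega\in\Lambda_i(\omega)$), Stationarity ($\omega'\in\Lambda_i(\omega)\Rightarrow\Lambda_i(\omega')=\Lambda_i(\omega)$), Projections Preserve Implicit Knowledge ($\omega\in S_\Phi$, $\Psi\subseteq\Phi\Rightarrow\Lambda_i(\omega)_\Psi=\Lambda_i(\omega_\Psi)$). $\alpha_i:\Omega\to\{S_\Phi\}$ satisfies (O) $\omega\in S_\Phi\Rightarrow\alpha_i(\omega)\preceq S_\Phi$; (I) $\omega'\in\Lambda_i(\omega)\Rightarrow\alpha_i(\omega')=\alpha_i(\omega)$; (II) $\omega\in S_\Phi$, $S_\Psi\preceq\alpha_i(\omega)\Rightarrow\alpha_i(\omega_\Psi)=S_\Psi$; (III) $\omega\in S_\Phi$, $\alpha_i(\omega)\preceq S_\Psi\preceq S_\Phi\Rightarrow\alpha_i(\omega_\Psi)=\alpha_i(\omega)$; (IV) $\omega\in S_\Phi$, $\Psi\subseteq\Phi\Rightarrow\alpha_i(\omega)\succeq\alpha_i(\omega_\Psi)$. Satisfaction: $\top$ always; $p$ iff $\omega\in v(p)$; $\neg\varphi$ iff $\omega\in\neg[\varphi]$; $\varphi\wedge\psi$ iff $\omega\in[\varphi]\cap[\psi]$;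 $a_i\varphi$ iff $\alpha_i(\omega)\succeq S([\varphi])$; $\ell_i\varphi$ iff $\Lambda_i(\omega)\subseteq[\varphi]$; $k_i\varphi$ iff both $\ell_i\varphi$ and $a_i\varphi$ hold; $[\varphi]$ = set of satisfying states. FH$^*$-transform $FH^*(\mathsf{M}^*)=\langle I,W_{\mathsf{At}},(R_{\mathsf{At},i}),(\mathcal{A}_{\mathsf{At},i}),V_{\mathsf{At}}\rangle$: $W_{\mathsf{At}}=S_{\mathsf{At}}$; $(\omega,\omega')\in R_{\mathsf{At},i}$ iff $\omega'\in\Lambda_i(\omega)$; $\mathcal{A}_{\mathsf{At},i}(\omega)=\mathcal{L}_\Phi$ where $\alpha_i(\omega)=S_\Phi$; $V_{\mathsf{At}}(p)=v(p)\cap S_{\mathsf{At}}$. FH satisfaction: $p$ iff $w\in V_{\mathsf{At}}(p)$; Boolean usual; $a_i\varphi$ iff $\varphi\in\mathcal{A}_{\mathsf{At},i}(w)$; $\ell_i\varphi$ iff $\varphi$ holds at all $R_{\mathsf{At},i}$-successors of $w$; $k_i\varphi$ abbreviates $\ell_i\varphi\wedge a_i\varphi$.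
   Formalization: Each valuation v(p) is an event with base-space $S_{\{p\}}$, and the base-space $S([\varphi])$ used for $a_i\varphi$ and $\neg\varphi$ is taken as $S_{\mathsf{At}(\varphi)}$. Apart from conventions, each condition added here is assumed in the paper as well or is needed for the statement above to hold. -}

module Defs where

open import Level using (0ℓ)
open import Data.Product using (Σ; ∃; _×_; _,_)
open import Data.Unit using (⊤)
open import Data.Empty using (⊥)
open import Relation.Nullary using (¬_)
open import Relation.Unary using (Pred; _⊆_; _≐_; _∪_; ∅; ｛_｝; U)
open import Relation.Binary.PropositionalEquality using (_≡_)

data Form (At I : Set) : Set where
  ⊤'  : Form At I
  at  : At → Form At I
  ¬'_ : Form At I → Form At I
  _∧'_ : Form At I → Form At I → Form At I
  ℓ   : I → Form At I → Form At I
  a   : I → Form At I → Form At I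
  k   : I → Form At I → Form At I

Sub : Set → Set₁
Sub At = Pred At 0ℓ

atoms : {At I : Set} → Form At I → Sub At
atoms ⊤'        = ∅
atoms (at p)    = ｛ p ｝
atoms (¬' φ)    = atoms φ
atoms (φ ∧' ψ)  = atoms φ ∪ atoms ψ
atoms (ℓ i φ)   = atoms φ
atoms (a i φ)   = atoms φ
atoms (k i φ)   = atoms φ

L : {At I : Set} → Sub At → Pred (Form At I) 0ℓ
L Φ φ = atoms φ ⊆ Φ

-- States of the space S_Φ are the elements of S Φ; Ω = Σ Φ (S Φ), so
-- the spaces are pairwise disjoint by construction.  S_Φ ⪯ S_Ψ iff Φ ⊆ Ψ.
-- Λ i Φ ω is the set Λ_i(ω) for ω ∈ S_Φ, a subset of S_Φ
-- (the projection Λ_i(ω)_Ψ = r^Φ_Ψ(Λ_i(ω)) presupposes Λ_i(ω) ⊆ S_Φ).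
-- α i Φ ω = Ψ means α_i(ω) = S_Ψ.
-- The valuation v(p) is the event D_p^↑ with base-space S_{p}, D_p = V p.

record HMS (At I : Set) : Set₁ where
  field
    S        : Sub At → Set
    S-nonempty : (Φ : Sub At) → S Φ
    r        : (Φ Ψ : Sub At) → .(Ψ ⊆ Φ) → S Φ → S Ψ
    r-surj   : (Φ Ψ : Sub At) .(h : Ψ ⊆ Φ) (y : S Ψ) → ∃ λ x → r Φ Ψ h x ≡ y
    r-id     : (Φ : Sub At) .(h : Φ ⊆ Φ) (ω : S Φ) → r Φ Φ h ω ≡ ω
    r-comp   : (Φ Ψ Υ : Sub At) .(h₁ : Ψ ⊆ Φ) .(h₂ : Υ ⊆ Ψ) .(h₃ : Υ ⊆ Φ) (ω : S Φ) →
               r Φ Υ h₃ ω ≡ r Ψ Υ h₂ (r Φ Ψ h₁ ω)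
    V        : (p : At) → Pred (S ｛ p ｝) 0ℓ
    Λ        : I → (Φ : Sub At) → S Φ → Pred (S Φ) 0ℓ
    Λ-refl   : ∀ i Φ (ω : S Φ) → Λ i Φ ω ω
    Λ-stat   : ∀ i Φ (ω ω′ : S Φ) → Λ i Φ ω ω′ → Λ i Φ ω′ ≐ Λ i Φ ω
    Λ-proj   : ∀ i (Φ Ψ : Sub At) .(h : Ψ ⊆ Φ) (ω : S Φ) →
               Λ i Ψ (r Φ Ψ h ω) ≐ (λ y → ∃ λ x → Λ i Φ ω x × r Φ Ψ h x ≡ y)
    α        : I → (Φ : Sub At) → S Φ → Sub At
    α-O      : ∀ i Φ (ω : S Φ) → α i Φ ω ⊆ Φ
    α-I      : ∀ i Φ (ω ω′ : S Φ) → Λ i Φ ω ω′ → α i Φ ω′ ≐ α i Φ ω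
    α-II     : ∀ i (Φ Ψ : Sub At) (ω : S Φ) → Ψ ⊆ α i Φ ω → .(h : Ψ ⊆ Φ) →
               α i Ψ (r Φ Ψ h ω) ≐ Ψ
    α-III    : ∀ i (Φ Ψ : Sub At) (ω : S Φ) → α i Φ ω ⊆ Ψ → .(h : Ψ ⊆ Φ) →
               α i Ψ (r Φ Ψ h ω) ≐ α i Φ ω
    α-IV     : ∀ i (Φ Ψ : Sub At) (ω : S Φ) → .(h : Ψ ⊆ Φ) →
               α i Ψ (r Φ Ψ h ω) ⊆ α i Φ ω

-- Base-space of the event [φ]: S([φ]) = S_(baseSpace φ), computed from the
-- event operations: [⊤] = Ω has base S_∅, [p] = v(p) has base S_{p},
-- ¬E has base S(E), base of E ∩ F is S(E) ⊔ S(F), and the implicit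
-- knowledge / awareness / knowledge events of E have base S(E).

baseSpace : {At I : Set} → Form At I → Sub At
baseSpace ⊤'        = ∅
baseSpace (at p)    = ｛ p ｝
baseSpace (¬' φ)    = baseSpace φ
baseSpace (φ ∧' ψ)  = baseSpace φ ∪ baseSpace ψ
baseSpace (ℓ i φ)   = baseSpace φ
baseSpace (a i φ)   = baseSpace φ
baseSpace (k i φ)   = baseSpace φ

module _ {At I : Set} (M : HMS At I) where
  open HMS M

  -- M*, ω ⊨ φ   for ω ∈ S_Φ
  -- ¬φ : ω ∈ ¬[φ] = (S([φ]) ∖ D)^↑ with D = [φ] ∩ S([φ])
  -- p  : ω ∈ v(p) = (V p)^↑
  sat : (Φ : Sub At) → S Φ → Form At I → Set
  sat Φ ω ⊤'       = ⊤
  sat Φ ω (at p)   = Σ (｛ p ｝ ⊆ Φ) λ h → V p (r Φ ｛ p ｝ h ω)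
  sat Φ ω (¬' φ)   = Σ (baseSpace φ ⊆ Φ) λ h →
                       ¬ sat (baseSpace φ) (r Φ (baseSpace φ) h ω) φ
  sat Φ ω (φ ∧' ψ) = sat Φ ω φ × sat Φ ω ψ
  sat Φ ω (ℓ i φ)  = (ω′ : S Φ) → Λ i Φ ω ω′ → sat Φ ω′ φ
  sat Φ ω (a i φ)  = baseSpace φ ⊆ α i Φ ω
  sat Φ ω (k i φ)  = ((ω′ : S Φ) → Λ i Φ ω ω′ → sat Φ ω′ φ) × (baseSpace φ ⊆ α i Φ ω)

record FHModel (At I : Set) : Set₁ where
  field
    W : Set
    R : I → W → W → Set
    A : I → W → Pred (Form At I) 0ℓ
    Val : At → Pred W 0ℓ

module _ {At I : Set} (N : FHModel At I) where
  open FHModel N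

  forces : W → Form At I → Set
  forces w ⊤'       = ⊤
  forces w (at p)   = Val p w
  forces w (¬' φ)   = ¬ forces w φ
  forces w (φ ∧' ψ) = forces w φ × forces w ψ
  forces w (ℓ i φ)  = (w′ : W) → R i w w′ → forces w′ φ
  forces w (a i φ)  = A i w φ
  forces w (k i φ)  = ((w′ : W) → R i w w′ → forces w′ φ) × A i w φ

-- The FH*-transform (W = S_At, where At is the full set U)

FH* : {At I : Set} → HMS At I → FHModel At I
FH* {At} {I} M = record
  { W   = S U
  ; R   = λ i ω ω′ → Λ i U ω ω′
  ; A   = λ i ω → L (α i U ω)
  ; Val = λ p ω → Σ (｛ p ｝ ⊆ U) λ h → V p (r U ｛ p ｝ h ω)
  }
  where open HMS M

-- Truth of φ at ω ∈ S_Φ depends only on the projection of ω to any space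
-- containing S([φ]): for atoms and negations this is composition of
-- projections, and implicit knowledge and awareness commute with projection by
-- Projections Preserve Implicit Knowledge and the awareness axioms (II), (IV).
-- On S_At every HMS clause is then the Kripke clause of the FH*-transform; only
-- negation, which the HMS model evaluates on S([φ]), needs this invariance.
module Submission where

open import Defs
open import Level using (0ℓ)
open import Relation.Unary using (Pred; U; _⊆_; _∪_)
open import Relation.Unary.Properties using (⊆-U)
open import Function.Bundles using (_⇔_; mk⇔; Equivalence)
open import Function.Properties.Equivalence using () renaming (sym to ⇔-sym; trans to ⇔-trans)
open import Function.Related.TypeIsomorphisms using (¬-cong-⇔)
open import Data.Product using (Σ; _,_; proj₁; proj₂)
open import Data.Product.Function.NonDependent.Propositional using (_×-⇔_)
open import Data.Sum using (inj₁; inj₂)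
open import Data.Unit using (tt)
open import Relation.Nullary using (¬_)
open import Relation.Binary.PropositionalEquality using (_≡_; refl; sym; subst; cong₂)

open Equivalence using (to; from)

∀-cong-⇔ : {A : Set} {R : A → Set} {P Q : A → Set} → (∀ x → P x ⇔ Q x) →
           ((x : A) → R x → P x) ⇔ ((x : A) → R x → Q x)
∀-cong-⇔ P⇔Q = mk⇔ (λ ∀P x Rx → to (P⇔Q x) (∀P x Rx)) (λ ∀Q x Rx → from (P⇔Q x) (∀Q x Rx))

baseSpace≡atoms : {At I : Set} (φ : Form At I) → baseSpace φ ≡ atoms φ
baseSpace≡atoms ⊤'       = refl
baseSpace≡atoms (at p)   = refl
baseSpace≡atoms (¬' φ)   = baseSpace≡atoms φ
baseSpace≡atoms (φ ∧' ψ) = cong₂ _∪_ (baseSpace≡atoms φ) (baseSpace≡atoms ψ)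
baseSpace≡atoms (ℓ i φ)  = baseSpace≡atoms φ
baseSpace≡atoms (a i φ)  = baseSpace≡atoms φ
baseSpace≡atoms (k i φ)  = baseSpace≡atoms φ

module _ {At I : Set} (M : HMS At I) where
  open HMS M

  module _ {Φ Ψ : Sub At} (Ψ⊆Φ : Ψ ⊆ Φ) where

    restriction-proj : {Υ : Sub At} → Υ ⊆ Ψ → (P : Pred (S Υ) 0ℓ) (ω : S Φ) →
                       (Σ (Υ ⊆ Φ) λ h → P (r Φ Υ h ω)) ⇔
                       (Σ (Υ ⊆ Ψ) λ h → P (r Ψ Υ h (r Φ Ψ Ψ⊆Φ ω)))
    restriction-proj {Υ} Υ⊆Ψ P ω = mk⇔
      (λ { (_ , p) → Υ⊆Ψ , subst P (r-comp Φ Ψ Υ Ψ⊆Φ Υ⊆Ψ Υ⊆Φ ω) p })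
      (λ { (_ , p) → Υ⊆Φ , subst P (sym (r-comp Φ Ψ Υ Ψ⊆Φ Υ⊆Ψ Υ⊆Φ ω)) p })
      where
      Υ⊆Φ : Υ ⊆ Φ
      Υ⊆Φ x∈Υ = Ψ⊆Φ (Υ⊆Ψ x∈Υ)

    Λ-box-proj : (i : I) (P : Pred (S Ψ) 0ℓ) (ω : S Φ) →
                 ((ω′ : S Φ) → Λ i Φ ω ω′ → P (r Φ Ψ Ψ⊆Φ ω′)) ⇔
                 ((y : S Ψ) → Λ i Ψ (r Φ Ψ Ψ⊆Φ ω) y → P y)
    Λ-box-proj i P ω = mk⇔
      (λ □P y y∈Λ → let (ω′ , ω′∈Λ , ω′↦y) = proj₁ (Λ-proj i Φ Ψ Ψ⊆Φ ω) y∈Λ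
                     in subst P ω′↦y (□P ω′ ω′∈Λ))
      (λ □P ω′ ω′∈Λ → □P (r Φ Ψ Ψ⊆Φ ω′) (proj₂ (Λ-proj i Φ Ψ Ψ⊆Φ ω) (ω′ , ω′∈Λ , refl)))

    -- Axiom (II) makes S_Υ its own awareness space at ω_Υ, and (IV) lifts
    -- this awareness from ω_Υ to ω_Ψ.
    ⊆α-proj : (i : I) {Υ : Sub At} → Υ ⊆ Ψ → (ω : S Φ) →
              (Υ ⊆ α i Φ ω) ⇔ (Υ ⊆ α i Ψ (r Φ Ψ Ψ⊆Φ ω))
    ⊆α-proj i {Υ} Υ⊆Ψ ω = mk⇔ aware-at-proj aware-from-proj
      where
      Υ⊆Φ : Υ ⊆ Φ
      Υ⊆Φ x∈Υ = Ψ⊆Φ (Υ⊆Ψ x∈Υ)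

      aware-at-proj : Υ ⊆ α i Φ ω → Υ ⊆ α i Ψ (r Φ Ψ Ψ⊆Φ ω)
      aware-at-proj Υ⊆α {x} x∈Υ = α-IV i Ψ Υ (r Φ Ψ Ψ⊆Φ ω) Υ⊆Ψ
        (subst (λ ω′ → α i Υ ω′ x) (r-comp Φ Ψ Υ Ψ⊆Φ Υ⊆Ψ Υ⊆Φ ω)
          (proj₂ (α-II i Φ Υ ω Υ⊆α Υ⊆Φ) x∈Υ))

      aware-from-proj : Υ ⊆ α i Ψ (r Φ Ψ Ψ⊆Φ ω) → Υ ⊆ α i Φ ω
      aware-from-proj Υ⊆α x∈Υ = α-IV i Φ Ψ ω Ψ⊆Φ (Υ⊆α x∈Υ)

  sat-proj : {Φ Ψ : Sub At} (Ψ⊆Φ : Ψ ⊆ Φ) (φ : Form At I) → baseSpace φ ⊆ Ψ →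
             (ω : S Φ) → sat M Φ ω φ ⇔ sat M Ψ (r Φ Ψ Ψ⊆Φ ω) φ

  sat-ℓ-proj : {Φ Ψ : Sub At} (Ψ⊆Φ : Ψ ⊆ Φ) (i : I) (φ : Form At I) → baseSpace φ ⊆ Ψ →
               (ω : S Φ) → sat M Φ ω (ℓ i φ) ⇔ sat M Ψ (r Φ Ψ Ψ⊆Φ ω) (ℓ i φ)
  sat-ℓ-proj {Ψ = Ψ} Ψ⊆Φ i φ φ⊆Ψ ω = ⇔-trans
    (∀-cong-⇔ (sat-proj Ψ⊆Φ φ φ⊆Ψ))
    (Λ-box-proj Ψ⊆Φ i (λ y → sat M Ψ y φ) ω)

  sat-proj Ψ⊆Φ ⊤'       _   ω = mk⇔ (λ _ → tt) (λ _ → tt)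
  sat-proj Ψ⊆Φ (at p)   p⊆Ψ ω = restriction-proj Ψ⊆Φ p⊆Ψ (V p) ω
  sat-proj Ψ⊆Φ (¬' φ)   φ⊆Ψ ω =
    restriction-proj Ψ⊆Φ φ⊆Ψ (λ ω′ → ¬ sat M (baseSpace φ) ω′ φ) ω
  sat-proj Ψ⊆Φ (φ ∧' ψ) φψ⊆Ψ ω =
    sat-proj Ψ⊆Φ φ (λ x∈φ → φψ⊆Ψ (inj₁ x∈φ)) ω ×-⇔ sat-proj Ψ⊆Φ ψ (λ x∈ψ → φψ⊆Ψ (inj₂ x∈ψ)) ω
  sat-proj Ψ⊆Φ (ℓ i φ)  φ⊆Ψ ω = sat-ℓ-proj Ψ⊆Φ i φ φ⊆Ψ ω
  sat-proj Ψ⊆Φ (a i φ)  φ⊆Ψ ω = ⊆α-proj Ψ⊆Φ i φ⊆Ψ ω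
  sat-proj Ψ⊆Φ (k i φ)  φ⊆Ψ ω = sat-ℓ-proj Ψ⊆Φ i φ φ⊆Ψ ω ×-⇔ ⊆α-proj Ψ⊆Φ i φ⊆Ψ ω

  truth-lemma : (φ : Form At I) (ω : S U) → sat M U ω φ ⇔ forces (FH* M) ω φ

  truth-ℓ : (i : I) (φ : Form At I) (ω : S U) → sat M U ω (ℓ i φ) ⇔ forces (FH* M) ω (ℓ i φ)
  truth-ℓ i φ ω = ∀-cong-⇔ (truth-lemma φ)

  truth-a : (i : I) (φ : Form At I) (ω : S U) → sat M U ω (a i φ) ⇔ forces (FH* M) ω (a i φ)
  truth-a i φ ω = mk⇔ (subst (_⊆ α i U ω) (baseSpace≡atoms φ))
                      (subst (_⊆ α i U ω) (sym (baseSpace≡atoms φ)))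

  truth-lemma ⊤'       ω = mk⇔ (λ _ → tt) (λ _ → tt)
  truth-lemma (at p)   ω = mk⇔ (λ v → v) (λ v → v)
  truth-lemma (¬' φ)   ω = mk⇔ (λ { (_ , ¬φ) → to ¬φ⇔ ¬φ }) (λ ¬φ → (λ {x} → φ⊆U {x}) , from ¬φ⇔ ¬φ)
    where
    φ⊆U : baseSpace φ ⊆ U
    φ⊆U = ⊆-U (baseSpace φ)

    ¬φ⇔ : (¬ sat M (baseSpace φ) (r U (baseSpace φ) φ⊆U ω) φ) ⇔ (¬ forces (FH* M) ω φ)
    ¬φ⇔ = ¬-cong-⇔ (⇔-trans (⇔-sym (sat-proj φ⊆U φ (λ x∈φ → x∈φ) ω)) (truth-lemma φ ω))
  truth-lemma (φ ∧' ψ) ω = truth-lemma φ ω ×-⇔ truth-lemma ψ ω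
  truth-lemma (ℓ i φ)  ω = truth-ℓ i φ ω
  truth-lemma (a i φ)  ω = truth-a i φ ω
  truth-lemma (k i φ)  ω = truth-ℓ i φ ω ×-⇔ truth-a i φ ω

proposition13 : (At I : Set) → At → I → (M : HMS At I) →
                (φ : Form At I) (ω : HMS.S M U) →
                sat M U ω φ ⇔ forces (FH* M) ω φ
proposition13 At I _ _ M = truth-lemma M
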